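{- Let $p$ be an odd prime and let $n,k$ be positive integers with $k\ge 3$, and let $p_1,\dots,p_{k-2}$ be positive integers with $\gcd(p_1,\dots,p_{k-2})=1$. For an integer $z$ with $1\le z\le np^2-1$ and $p\nmid z$, write $z=x+yp$ with $1\le x\le p-1$ and $y\ge 0$ an integer, and for $1\le i\le p$ put $d^{z}_i=(i-1)xpn+z$ and let $R^{np^3,z}_i\subseteq\mathbb{Z}_{np^3}$ be the set of residues modulo $np^3$ of $$d^z_i,\ np^2-d^z_i,\ np^2+d^z_i,\ 2np^2-d^z_i,\ 2np^2+d^z_i,\ \dots,\ (p-1)np^2-d^z_i,\ (p-1)np^2+d^z_i,\ np^3-d^z_i,$$ $$pp_1,\ \dots,\ pp_{k-2},\ p(np^3-p_{k-2}),\ \dots,\ p(np^3-p_1).$$ Then for every such $z=x+yp$ (with $0\le y\le np-1$) and every $1\le i\le p$, $R^{np^3,\,np^2-x-yp}_i=R^{np^3,\,x+yp}_i$.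
   Context: All sets are subsets of $\mathbb{Z}_{np^3}$, i.e. their elements are taken modulo $np^3$. Note that $np^2-x-yp=(p-x)+(np-1-y)p$, so the superscript $np^2-x-yp$ is decomposed with residue part $p-x$. -}

module Defs where

open import Data.Nat as ℕ using (ℕ; suc; _∸_; NonZero)
open import Data.Nat.DivMod using (_%_)
open import Data.Nat.GCD using (gcd)
open import Data.Integer as ℤ using (ℤ; +_)
open import Data.Integer.Divisibility using () renaming (_∣_ to _∣ℤ_)
open import Data.List using (List; _∷_; []; _++_; map; concatMap; upTo; foldr)
open import Data.List.Relation.Unary.Any using (Any)
open import Data.Product using (_×_)

gcdList : List ℕ → ℕ
gcdList = foldr gcd 0

resPart : (p z : ℕ) → .{{_ : NonZero p}} → ℕ
resPart p z = z % p

dval : (n p z i : ℕ) → .{{_ : NonZero p}} → ℕ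
dval n p z i = (i ∸ 1) ℕ.* resPart p z ℕ.* p ℕ.* n ℕ.+ z

Rlist : (n p : ℕ) → List ℕ → (z i : ℕ) → .{{_ : NonZero p}} → List ℤ
Rlist n p ps z i =
     + d
  ∷ concatMap (λ m → (+ (m ℕ.* M) ℤ.- + d) ∷ (+ (m ℕ.* M) ℤ.+ + d) ∷ [])
              (map suc (upTo (p ∸ 1)))
  ++ (+ N ℤ.- + d)
  ∷ map (λ q → + (p ℕ.* q)) ps
  ++ map (λ q → + p ℤ.* (+ N ℤ.- + q)) ps
  where
    d = dval n p z i
    M = n ℕ.* p ℕ.^ 2
    N = n ℕ.* p ℕ.^ 3

-- R^{np^3,z}_i as a subset of Z_{np^3}, elements represented by 0 ≤ r < np^3:
-- r belongs iff r is the residue mod np^3 of one of the listed integers.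
R : (n p : ℕ) → List ℕ → (z i : ℕ) → .{{_ : NonZero p}} → ℕ → Set
R n p ps z i r =
  r ℕ.< n ℕ.* p ℕ.^ 3 × Any (λ a → (+ (n ℕ.* p ℕ.^ 3)) ∣ℤ (a ℤ.- + r)) (Rlist n p ps z i)

{-# OPTIONS --safe #-}
module Submission where

open import Defs

-- Write M = n p², N = p M = n p³, and d, d′ for the values d^z_i, d^{M-z}_i.  As p ∤ z ≤ M, the
-- residues of z and M - z mod p are nonzero and sum to p, whence d + d′ = i M.  Modulo N, the values
-- d, j M ± d (0 < j < p) and N - d are exactly the residues r with r ≡ ±d (mod M), and d′ ≡ -d (mod M)
-- gives the same family; the terms p p_j and p (N - p_j) do not involve z.

module ResidueComplement where
  open import Data.Nat using (ℕ; zero; suc; _+_; _*_; _≤_; _<_; _∸_; _^_; NonZero)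
  open import Data.Nat.Properties
    using (≤-trans; <⇒≱; ≤-reflexive; m≤m+n; +-monoʳ-≤; +-mono-<; +-identityʳ; n≢0⇒n>0; m+[n∸m]≡n; m∸n+n≡m)
  open import Data.Nat.DivMod using (_%_; m%n<n; %-distribˡ-+)
  open import Data.Nat.Divisibility using (_∣_; divides; m%n≡0⇒n∣m; n∣m⇒m%n≡0; ∣m+n∣m⇒∣n)
  open import Data.Empty using (⊥-elim)
  open import Function using (_∘_)
  open import Relation.Nullary using (¬_)
  open import Relation.Binary.PropositionalEquality
  open import Data.Nat.Tactic.RingSolver using (solve-∀)
  open import Data.Nat.Solver using (module +-*-Solver)
  open +-*-Solver using (solve; _:+_; _:*_; _:^_; _:=_; con)

  n∣a+b⇒a+b≡n : ∀ {n a b} → 0 < a → 0 < b → a < n → b < n → n ∣ a + b → a + b ≡ n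
  n∣a+b⇒a+b≡n {a = a} 0<a _ _ _ (divides zero a+b≡0) =
    ⊥-elim (<⇒≱ (≤-trans 0<a (m≤m+n a _)) (≤-reflexive a+b≡0))
  n∣a+b⇒a+b≡n {n} _ _ _ _ (divides (suc zero) a+b≡n) = trans a+b≡n (+-identityʳ n)
  n∣a+b⇒a+b≡n {n} _ _ a<n b<n (divides (suc (suc q)) a+b≡q*n) =
    ⊥-elim (<⇒≱ (+-mono-< a<n b<n) (≤-trans n+n≤[2+q]n (≤-reflexive (sym a+b≡q*n))))
    where n+n≤[2+q]n : n + n ≤ suc (suc q) * n
          n+n≤[2+q]n = +-monoʳ-≤ n (m≤m+n n (q * n))

  residue-complement : ∀ p {m z} .{{_ : NonZero p}} → p ∣ m → z ≤ m → ¬ p ∣ z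
                     → z % p + (m ∸ z) % p ≡ p
  residue-complement p {m} {z} p∣m z≤m p∤z =
    n∣a+b⇒a+b≡n (residue>0 p∤z) (residue>0 p∤m∸z) (m%n<n z p) (m%n<n (m ∸ z) p)
                (m%n≡0⇒n∣m _ p sum%p≡0)
    where
      residue>0 : ∀ {w} → ¬ p ∣ w → 0 < w % p
      residue>0 {w} p∤w = n≢0⇒n>0 (p∤w ∘ m%n≡0⇒n∣m w p)

      p∤m∸z : ¬ p ∣ m ∸ z
      p∤m∸z p∣m∸z = p∤z (∣m+n∣m⇒∣n (subst (p ∣_) (sym (m∸n+n≡m z≤m)) p∣m) p∣m∸z)

      sum%p≡0 : (z % p + (m ∸ z) % p) % p ≡ 0
      sum%p≡0 = begin
        (z % p + (m ∸ z) % p) % p ≡⟨ %-distribˡ-+ z (m ∸ z) p ⟨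
        (z + (m ∸ z)) % p         ≡⟨ cong (_% p) (m+[n∸m]≡n z≤m) ⟩
        m % p                     ≡⟨ n∣m⇒m%n≡0 m p p∣m ⟩
        0                         ∎
        where open ≡-Reasoning

  np²≡np*p : ∀ n p → n * p ^ 2 ≡ n * p * p
  np²≡np*p = solve 2 (λ n p → n :* p :^ 2 := n :* p :* p) refl

  dval-complement : ∀ n p z i .{{_ : NonZero p}} → 1 ≤ i → z ≤ n * p ^ 2 → ¬ p ∣ z
                  → dval n p z i + dval n p (n * p ^ 2 ∸ z) i ≡ i * (n * p ^ 2)
  dval-complement n p z i 1≤i z≤M p∤z = begin
    a * x * p * n + z + (a * x′ * p * n + (M ∸ z)) ≡⟨ regroup a x x′ p n z (M ∸ z) ⟩
    a * (x + x′) * p * n + (z + (M ∸ z))          ≡⟨ cong₂ (λ s t → a * s * p * n + t) x+x′≡p (m+[n∸m]≡n z≤M) ⟩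
    a * p * p * n + M                              ≡⟨ collect a p n ⟩
    suc a * M                                      ≡⟨ cong (_* M) (m+[n∸m]≡n 1≤i) ⟩
    i * M                                          ∎
    where
      open ≡-Reasoning
      a M x x′ : ℕ
      a = i ∸ 1
      M = n * p ^ 2
      x = z % p
      x′ = (M ∸ z) % p

      x+x′≡p : x + x′ ≡ p
      x+x′≡p = residue-complement p (divides (n * p) (np²≡np*p n p)) z≤M p∤z

      regroup : ∀ a x x′ p n z w → a * x * p * n + z + (a * x′ * p * n + w) ≡ a * (x + x′) * p * n + (z + w)
      regroup = solve-∀

      collect : ∀ a p n → a * p * p * n + n * p ^ 2 ≡ suc a * (n * p ^ 2)
      collect = solve 3 (λ a p n → a :* p :* p :* n :+ n :* p :^ 2 := (con 1 :+ a) :* (n :* p :^ 2)) refl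

  np³≡p*np² : ∀ n p → n * p ^ 3 ≡ p * (n * p ^ 2)
  np³≡p*np² = solve 2 (λ n p → n :* p :^ 3 := p :* (n :* p :^ 2)) refl

module PlusMinusResidues where
  open import Data.Nat as ℕ using (ℕ; zero; suc; _∸_; _<_; NonZero)
  open import Data.Nat.Properties using (∸-monoˡ-≤)
  open import Data.Integer using (ℤ; +_; _+_; _-_; _*_; -_)
  open import Data.Integer.Properties using (pos-+; pos-*; +-comm)
  open import Data.Integer.DivMod using (_%_; _/_; n%d<d; a≡a%n+[a/n]*n)
  open import Data.Integer.Divisibility.Signed
    using (_∣_; divides; ∣-refl; ∣-trans; ∣m∣n⇒∣m+n; ∣m∣n⇒∣m-n; ∣n⇒∣m*n; ∣⇒∣ᵤ; ∣ᵤ⇒∣)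
  import Data.Integer.Divisibility as Unsigned
  open import Data.Integer.Tactic.RingSolver using (solve-∀)
  open import Data.List using (List; _∷_; []; _++_; map; concatMap; upTo)
  open import Data.List.Relation.Unary.Any as Any using (Any; here; there)
  open import Data.List.Relation.Unary.Any.Properties using (++⁺ˡ; ++⁺ʳ; ++⁻; concatMap⁺; concatMap⁻)
  open import Data.List.Membership.Propositional using (lose)
  open import Data.List.Membership.Propositional.Properties using (∈-map⁺; ∈-upTo⁺)
  open import Data.Product using (∃-syntax; _×_; _,_)
  open import Data.Sum as Sum using (_⊎_; inj₁; inj₂)
  open import Function using (_∘_)
  open import Function.Bundles using (_⇔_; mk⇔)
  import Function.Properties.Equivalence as ⇔
  open import Data.Sum.Function.Propositional using (_⊎-⇔_)
  open import Relation.Binary.PropositionalEquality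

  ±-complement : ∀ {m d d′ c r} → d + d′ ≡ c * m
               → (m ∣ r - d ⊎ m ∣ r + d) ⇔ (m ∣ r - d′ ⊎ m ∣ r + d′)
  ±-complement {m} {d} {d′} {c} {r} d+d′≡cm =
    mk⇔ (Sum.swap ∘ Sum.map (sub⇒add d+d′≡cm) (add⇒sub d+d′≡cm))
        (Sum.swap ∘ Sum.map (sub⇒add d′+d≡cm) (add⇒sub d′+d≡cm))
    where
      d′+d≡cm : d′ + d ≡ c * m
      d′+d≡cm = trans (+-comm d′ d) d+d′≡cm

      sub⇒add : ∀ {e e′} → e + e′ ≡ c * m → m ∣ r - e → m ∣ r + e′
      sub⇒add {e} {e′} e+e′≡cm m∣r-e =
        subst (m ∣_) (trans (cong (λ s → r - e + s) (sym e+e′≡cm)) (lemma r e e′))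
              (∣m∣n⇒∣m+n m∣r-e (∣n⇒∣m*n c ∣-refl))
        where lemma : ∀ r e e′ → r - e + (e + e′) ≡ r + e′
              lemma = solve-∀

      add⇒sub : ∀ {e e′} → e + e′ ≡ c * m → m ∣ r + e → m ∣ r - e′
      add⇒sub {e} {e′} e+e′≡cm m∣r+e =
        subst (m ∣_) (trans (cong (λ s → r + e - s) (sym e+e′≡cm)) (lemma r e e′))
              (∣m∣n⇒∣m-n m∣r+e (∣n⇒∣m*n c ∣-refl))
        where lemma : ∀ r e e′ → r + e - (e + e′) ≡ r - e′
              lemma = solve-∀

  module PlusMinusList (p : ℕ) .{{_ : NonZero p}} (M N : ℕ) (N≡p*M : N ≡ p ℕ.* M) where

    pmPair : ℕ → ℕ → List ℤ
    pmPair d m = (+ (m ℕ.* M) - + d) ∷ (+ (m ℕ.* M) + + d) ∷ []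

    pmPairs : ℕ → List ℤ
    pmPairs d = concatMap (pmPair d) (map suc (upTo (p ∸ 1)))

    pmList : ℕ → List ℤ → List ℤ
    pmList d rest = + d ∷ pmPairs d ++ (+ N - + d) ∷ rest

    private
      +N≡p*M : + N ≡ + p * + M
      +N≡p*M = trans (cong +_ N≡p*M) (pos-* p M)

      M∣N : + M ∣ + N
      M∣N = divides (+ p) +N≡p*M

      M∣jM : ∀ j → + M ∣ + (j ℕ.* M)
      M∣jM j = divides (+ j) (pos-* j M)

    reduce-mod-p : ∀ {x} → + M ∣ x → ∃[ j ] j < p × + N ∣ + (j ℕ.* M) - x
    reduce-mod-p {x} (divides t x≡tM) = t % + p , n%d<d t (+ p) , divides (- (t / + p)) (begin
      + (j ℕ.* M) - x                           ≡⟨ cong₂ _-_ (pos-* j M) x≡tM ⟩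
      + j * + M - t * + M                       ≡⟨ cong (λ s → + j * + M - s * + M) (a≡a%n+[a/n]*n t (+ p)) ⟩
      + j * + M - (+ j + t / + p * + p) * + M   ≡⟨ cancel (+ j) (t / + p) (+ p) (+ M) ⟩
      - (t / + p) * (+ p * + M)                 ≡⟨ cong (- (t / + p) *_) +N≡p*M ⟨
      - (t / + p) * + N                         ∎)
      where
        open ≡-Reasoning
        j : ℕ
        j = t % + p
        cancel : ∀ j q p m → j * m - (j + q * p) * m ≡ - q * (p * m)
        cancel = solve-∀

    CongruentTo : ℤ → ℤ → Set
    CongruentTo r a = + N Unsigned.∣ a - r

    Classes : ℤ → ℤ → List ℤ → Set
    Classes r d rest = (+ M ∣ r - d ⊎ + M ∣ r + d) ⊎ Any (CongruentTo r) rest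

    private
      plus-sound : ∀ t d r → + M ∣ t → + N ∣ t + d - r → + M ∣ r - d
      plus-sound t d r M∣t N∣t+d-r =
        subst (+ M ∣_) (lemma t d r) (∣m∣n⇒∣m-n M∣t (∣-trans M∣N N∣t+d-r))
        where lemma : ∀ t d r → t - (t + d - r) ≡ r - d
              lemma = solve-∀

      minus-sound : ∀ t d r → + M ∣ t → + N ∣ t - d - r → + M ∣ r + d
      minus-sound t d r M∣t N∣t-d-r =
        subst (+ M ∣_) (lemma t d r) (∣m∣n⇒∣m-n M∣t (∣-trans M∣N N∣t-d-r))
        where lemma : ∀ t d r → t - (t - d - r) ≡ r + d
              lemma = solve-∀

      pmPairs⁺ : ∀ {d} {P : ℤ → Set} m → suc m < p → Any P (pmPair d (suc m)) → Any P (pmPairs d)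
      pmPairs⁺ {d} m m+1<p P[m+1] = concatMap⁺ (pmPair d) (lose (∈-map⁺ suc (∈-upTo⁺ (∸-monoˡ-≤ 1 m+1<p))) P[m+1])

      plus∈ : ∀ {d rest r} j → j < p → + N ∣ + (j ℕ.* M) + + d - r → Any (CongruentTo r) (pmList d rest)
      plus∈ zero    _   N∣ = here (∣⇒∣ᵤ N∣)
      plus∈ (suc m) j<p N∣ = there (++⁺ˡ (pmPairs⁺ m j<p (there (here (∣⇒∣ᵤ N∣)))))

      minus∈ : ∀ {d rest r} j → j < p → + N ∣ + (j ℕ.* M) - + d - r → Any (CongruentTo r) (pmList d rest)
      minus∈ {d} {_} {r} zero _ N∣ =
        there (++⁺ʳ (pmPairs d) (here (∣⇒∣ᵤ (subst (+ N ∣_) (lemma (+ d) r (+ N)) (∣m∣n⇒∣m+n N∣ ∣-refl)))))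
        where lemma : ∀ d r n → + 0 - d - r + n ≡ n - d - r
              lemma = solve-∀
      minus∈ (suc m) j<p N∣ = there (++⁺ˡ (pmPairs⁺ m j<p (here (∣⇒∣ᵤ N∣))))

    classes-sound : ∀ {d rest r} → Any (CongruentTo r) (pmList d rest) → Classes r (+ d) rest
    classes-sound {d} {_} {r} (here N∣) = inj₁ (inj₁ (plus-sound (+ 0) (+ d) r (M∣jM 0) (∣ᵤ⇒∣ N∣)))
    classes-sound {d} {_} {r} (there a) with ++⁻ (pmPairs d) a
    ... | inj₂ (here N∣)  = inj₁ (inj₂ (minus-sound (+ N) (+ d) r M∣N (∣ᵤ⇒∣ N∣)))
    ... | inj₂ (there a′) = inj₂ a′
    ... | inj₁ a′ with Any.satisfied (concatMap⁻ (pmPair d) {xs = map suc (upTo (p ∸ 1))} a′)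
    ...   | m , here N∣         = inj₁ (inj₂ (minus-sound (+ (m ℕ.* M)) (+ d) r (M∣jM m) (∣ᵤ⇒∣ N∣)))
    ...   | m , there (here N∣) = inj₁ (inj₁ (plus-sound (+ (m ℕ.* M)) (+ d) r (M∣jM m) (∣ᵤ⇒∣ N∣)))

    classes-complete : ∀ {d rest r} → Classes r (+ d) rest → Any (CongruentTo r) (pmList d rest)
    classes-complete {d} {_} {r} (inj₁ (inj₁ M∣r-d)) with reduce-mod-p M∣r-d
    ... | j , j<p , N∣ = plus∈ j j<p (subst (+ N ∣_) (lemma (+ (j ℕ.* M)) r (+ d)) N∣)
      where lemma : ∀ t r d → t - (r - d) ≡ t + d - r
            lemma = solve-∀
    classes-complete {d} {_} {r} (inj₁ (inj₂ M∣r+d)) with reduce-mod-p M∣r+d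
    ... | j , j<p , N∣ = minus∈ j j<p (subst (+ N ∣_) (lemma (+ (j ℕ.* M)) r (+ d)) N∣)
      where lemma : ∀ t r d → t - (r + d) ≡ t - d - r
            lemma = solve-∀
    classes-complete {d} (inj₂ a) = there (++⁺ʳ (pmPairs d) (there a))

    pmList⇔classes : ∀ {d rest r} → Any (CongruentTo r) (pmList d rest) ⇔ Classes r (+ d) rest
    pmList⇔classes = mk⇔ classes-sound classes-complete

    classes-complement : ∀ {r rest d d′} c → d ℕ.+ d′ ≡ c ℕ.* M → Classes r (+ d) rest ⇔ Classes r (+ d′) rest
    classes-complement {r} {_} {d} {d′} c d+d′≡cM =
      ±-complement {+ M} {+ d} {+ d′} {+ c} {r} +d+d′≡cM ⊎-⇔ ⇔.refl
      where +d+d′≡cM : + d + + d′ ≡ + c * + M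
            +d+d′≡cM = trans (sym (pos-+ d d′)) (trans (cong +_ d+d′≡cM) (pos-* c M))

open import Data.Nat using (ℕ; _+_; _≤_; _∸_; _*_; _^_; NonZero)
open import Data.Nat.Properties using (≤-trans; m∸n≤m)
open import Data.Nat.Divisibility using (_∣_)
open import Data.Nat.Primality using (Prime)
open import Data.Vec using (Vec; toList)
open import Data.Vec.Relation.Unary.All using (All)
open import Data.Product.Function.NonDependent.Propositional using (_×-⇔_)
open import Relation.Nullary using (¬_)
open import Relation.Binary.PropositionalEquality using (_≡_)
open import Function.Bundles using (_⇔_)
import Function.Properties.Equivalence as ⇔
open ResidueComplement using (np³≡p*np²; dval-complement)
open PlusMinusResidues using (module PlusMinusList)

lemma2p6 : (p n k : ℕ) → .{{_ : NonZero p}} → Prime p → ¬ (2 ∣ p) → 1 ≤ n → 3 ≤ k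
    → (ps : Vec ℕ (k ∸ 2)) → All (λ q → 1 ≤ q) ps → gcdList (toList ps) ≡ 1
    → (z : ℕ) → 1 ≤ z → z ≤ n * p ^ 2 ∸ 1 → ¬ (p ∣ z)
    → (i : ℕ) → 1 ≤ i → i ≤ p
    → (r : ℕ) → R n p (toList ps) (n * p ^ 2 ∸ z) i r ⇔ R n p (toList ps) z i r
lemma2p6 p n _ _ _ _ _ _ _ _ z _ z≤M∸1 p∤z i 1≤i _ _ =
  ⇔.refl ×-⇔ ⇔.trans pmList⇔classes (⇔.trans (⇔.sym (classes-complement i d+d′≡iM)) (⇔.sym pmList⇔classes))
  where
    open PlusMinusList p (n * p ^ 2) (n * p ^ 3) (np³≡p*np² n p)

    d+d′≡iM : dval n p z i + dval n p (n * p ^ 2 ∸ z) i ≡ i * (n * p ^ 2)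
    d+d′≡iM = dval-complement n p z i 1≤i (≤-trans z≤M∸1 (m∸n≤m _ 1)) p∤z
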